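{- For every finite simple graph $G$, $\mathrm{im}(G)\leq\theta(G)\leq\mathrm{ccn}(G)\leq\text{min-m}(G)$.
   Context: For a finite simple graph $G$, $\theta(G)$ is defined recursively by: $\theta(G)=0$ if $G$ has no edges, and otherwise $\theta(G)=\min_{v}\max\{\theta(G-v),\ \theta(G-N_G[v])+1\}$, the minimum over non-isolated vertices $v$, where $N_G[v]$ is the closed neighborhood of $v$ (this is the theta-number of the independence complex of $G$). $\mathrm{im}(G)$ is the maximum size of an induced matching (a set of pairwise vertex-disjoint edges with no edge of $G$ joining vertices of two different edges of the set). A vertex cover of $G$ is a set $F\subseteq V(G)$ whose complement is independent; $\alpha(H)$ is the independence number of $H$; $\mathrm{ccn}(G)=\min\{\alpha(G[F]) : F \text{ a vertex cover of } G\}$. $\text{min-m}(G)$ is the minimum size of a maximal (inclusion-wise) matching of $G$. -}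

module Defs where

open import Data.Bool using (Bool; true; false; _∧_; _∨_; not; if_then_else_)
open import Data.Nat using (ℕ; zero; suc; _⊔_; _⊓_; _<ᵇ_)
open import Data.Fin using (Fin; toℕ) renaming (_≟_ to _≟ᶠ_)
open import Data.List using (List; []; _∷_; map; length; foldr; concatMap; allFin; _++_)
open import Data.Bool.ListAction using (all; any)
open import Data.Product using (_×_; _,_; proj₁; proj₂)
open import Relation.Nullary.Decidable using (⌊_⌋)
open import Relation.Binary.PropositionalEquality using (_≡_)

record Graph : Set where
  field
    n     : ℕ
    adj   : Fin n → Fin n → Bool
    sym   : ∀ u v → adj u v ≡ adj v u
    irrefl : ∀ v → adj v v ≡ false
open Graph public

sublists : {A : Set} → List A → List (List A)
sublists []       = [] ∷ []
sublists (x ∷ xs) = let r = sublists xs in r ++ map (x ∷_) r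

boolFilter : {A : Set} → (A → Bool) → List A → List A
boolFilter p []       = []
boolFilter p (x ∷ xs) = if p x then x ∷ boolFilter p xs else boolFilter p xs

maxList : List ℕ → ℕ
maxList = foldr _⊔_ 0

-- minimum of a list (0 for the empty list; only used on nonempty lists)
minList : List ℕ → ℕ
minList []       = 0
minList (x ∷ xs) = foldr _⊓_ x xs

module _ (G : Graph) where

  V : Set
  V = Fin (n G)

  eqᵇ : V → V → Bool
  eqᵇ u v = ⌊ u ≟ᶠ v ⌋

  memᵇ : V → List V → Bool
  memᵇ v xs = any (eqᵇ v) xs

  vertices : List V
  vertices = allFin (n G)

  -- the edges of G, each listed once as (u , v) with u < v
  Edge : Set
  Edge = V × V

  edges : List Edge
  edges = boolFilter (λ e → (toℕ (proj₁ e) <ᵇ toℕ (proj₂ e)) ∧ adj G (proj₁ e) (proj₂ e))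
                     (concatMap (λ u → map (u ,_) vertices) vertices)

  independentᵇ : List V → Bool
  independentᵇ I = all (λ u → all (λ v → not (adj G u v)) I) I

  α : List V → ℕ
  α F = maxList (map length (boolFilter independentᵇ (sublists F)))

  -- F is a vertex cover iff its complement is independent
  isVertexCoverᵇ : List V → Bool
  isVertexCoverᵇ F = independentᵇ (boolFilter (λ v → not (memᵇ v F)) vertices)

  ccn : ℕ
  ccn = minList (map α (boolFilter isVertexCoverᵇ (sublists vertices)))

  disjointᵇ : Edge → Edge → Bool
  disjointᵇ (a , b) (c , d) =
    not (eqᵇ a c ∨ eqᵇ a d ∨ eqᵇ b c ∨ eqᵇ b d)

  unjoinedᵇ : Edge → Edge → Bool
  unjoinedᵇ (a , b) (c , d) =
    not (adj G a c ∨ adj G a d ∨ adj G b c ∨ adj G b d)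

  isMatchingᵇ : List Edge → Bool
  isMatchingᵇ []       = true
  isMatchingᵇ (e ∷ M)  = all (disjointᵇ e) M ∧ isMatchingᵇ M

  isInducedMatchingᵇ : List Edge → Bool
  isInducedMatchingᵇ []      = true
  isInducedMatchingᵇ (e ∷ M) =
    all (λ f → disjointᵇ e f ∧ unjoinedᵇ e f) M ∧ isInducedMatchingᵇ M

  edgeEqᵇ : Edge → Edge → Bool
  edgeEqᵇ (a , b) (c , d) = eqᵇ a c ∧ eqᵇ b d

  isMaximalMatchingᵇ : List Edge → Bool
  isMaximalMatchingᵇ M =
    isMatchingᵇ M ∧
    all (λ e → any (edgeEqᵇ e) M ∨ not (isMatchingᵇ (e ∷ M))) edges

  im : ℕ
  im = maxList (map length (boolFilter isInducedMatchingᵇ (sublists edges)))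

  min-m : ℕ
  min-m = minList (map length (boolFilter isMaximalMatchingᵇ (sublists edges)))

  -- θ ------------------------------------------------------------------------
  -- Induced subgraphs G[S] are given by S : V → Bool.

  hasEdgeᵇ : (V → Bool) → Bool
  hasEdgeᵇ S = any (λ e → S (proj₁ e) ∧ S (proj₂ e)) edges

  nonIsolatedᵇ : (V → Bool) → V → Bool
  nonIsolatedᵇ S v = S v ∧ any (λ u → S u ∧ adj G v u) vertices

  delete : (V → Bool) → V → (V → Bool)
  delete S v u = S u ∧ not (eqᵇ u v)

  deleteClosedNbhd : (V → Bool) → V → (V → Bool)
  deleteClosedNbhd S v u = S u ∧ not (eqᵇ u v) ∧ not (adj G v u)

  -- Every recursive call removes
  -- at least one vertex of S, so fuel ≥ |S| is never exhausted on a graph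
  -- with edges; θ uses fuel n G for S = all vertices.
  θ-aux : ℕ → (V → Bool) → ℕ
  θ-aux zero    S = 0
  θ-aux (suc f) S =
    if hasEdgeᵇ S
    then minList (map (λ v → θ-aux f (delete S v) ⊔ suc (θ-aux f (deleteClosedNbhd S v)))
                      (boolFilter (nonIsolatedᵇ S) vertices))
    else 0

  θ : ℕ
  θ = θ-aux (n G) (λ _ → true)

{-# OPTIONS --safe #-}
module Submission where

-- im ≤ θ follows the recursion defining θ. Given an induced matching M of G[S] and a
-- non-isolated vertex v, either v misses M, and M is an induced matching of G[S − v], or
-- v lies on exactly one edge of M and, M being induced, the remaining edges form an
-- induced matching of G[S − N[v]], which the +1 pays for.
-- θ ≤ ccn: if F is a vertex cover of G[S], some non-isolated vertex c of G[S] lies in F.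
-- F still covers G[S − c], and every independent subset of F ∩ (S − N[c]) extends by c,
-- so in the branch that adds 1 the bound on independent subsets of F drops by one.
-- ccn ≤ min-m: the vertices saturated by a maximal matching M form a vertex cover, and an
-- independent set of them contains at most one endpoint of each edge of M.

open import Defs hiding (sym)
open import Data.Bool using (Bool; true; false; T; not; _∧_; _∨_; if_then_else_)
open import Data.Bool.Properties using (T-∧; T-∨)
open import Data.Bool.ListAction using (all; any)
open import Data.Empty using (⊥-elim)
open import Data.Fin using (toℕ)
open import Data.Fin.Properties using () renaming (<-cmp to <-cmpᶠ; _≟_ to _≟ᶠ_)
open import Data.List using (List; []; _∷_; map; length; filter; filterᵇ; concatMap)
open import Data.List.Membership.Propositional using (_∈_; _∉_; find; lose)
import Data.List.Membership.DecPropositional as DecMembership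
open import Data.List.Membership.Propositional.Properties
  using ( ∈-map⁺; ∈-map⁻; ∈-filter⁺; ∈-filter⁻; ∈-allFin; ∈-concatMap⁺
        ; ∈-++⁺ˡ; ∈-++⁺ʳ; ∈-++⁻)
open import Data.List.Properties
  using (filter-notAll; filter-none; length-tabulate; foldr-preservesᵇ; foldr-preservesᵒ)
open import Data.List.Relation.Binary.Sublist.Propositional
  using (_⊆_; []; _∷_; _∷ʳ_; ⊆-refl; ⊆-trans)
open import Data.List.Relation.Binary.Sublist.Propositional.Properties
  using (filter-⊆; All-resp-⊆; Any-resp-⊆; length-mono-≤)
open import Data.List.Relation.Unary.All as All using (All; []; _∷_)
open import Data.List.Relation.Unary.Any as Any using (Any; here; there)
open import Data.List.Relation.Unary.Any.Properties using (any⁺; any⁻)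
open import Data.List.Relation.Unary.All.Properties
  using (all⁺; all⁻; ¬All⇒Any¬; Any¬⇒¬All; ¬Any⇒All¬)
open import Data.List.Relation.Unary.AllPairs using (AllPairs; []; _∷_)
import Data.List.Relation.Unary.AllPairs.Properties as AllPairsₚ
open import Data.List.Relation.Unary.Unique.Propositional using (Unique)
open import Data.List.Relation.Unary.Unique.Propositional.Properties using (allFin⁺)
open import Data.Nat using (ℕ; zero; suc; _≤_; _<_; _+_; _⊔_; z≤n; s≤s; _<ᵇ_)
open import Data.Nat.Properties
  using ( ≤-refl; ≤-reflexive; ≤-trans; ≤-pred; <-≤-trans; <⇒≱; <⇒<ᵇ; +-suc; +-monoˡ-≤
        ; m≤m⊔n; m≤n⇒m≤n⊔o; m≤n⇒m≤o⊔n; ⊔-lub; m≤n⇒m⊓o≤n; m≤n⇒o⊓m≤n; ⊓-glb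
        ; module ≤-Reasoning)
open import Data.Product using (_×_; _,_; proj₁; proj₂; ∃-syntax)
open import Data.Sum using (_⊎_; inj₁; inj₂; [_,_]′)
open import Data.Unit using (tt)
open import Function using (_∘_; id; Equivalence)
open import Relation.Binary using (Symmetric; tri<; tri≈; tri>)
open import Relation.Binary.PropositionalEquality
  using (_≡_; _≢_; _≗_; refl; sym; trans; cong; subst; ≢-sym)
open import Relation.Nullary using (¬_; Dec; yes; no; does)
open import Relation.Nullary.Decidable using (T?; fromWitness; toWitness; _⊎-dec_)
open import Relation.Unary using (Decidable)
open import Relation.Unary.Properties using (∁?)

private variable
  A : Set
  x y : A
  xs ys : List A

T-not⁺ : ∀ {b} → ¬ T b → T (not b)
T-not⁺ {false} _  = tt
T-not⁺ {true}  ¬t = ¬t tt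

T-not⁻ : ∀ {b} → T (not b) → ¬ T b
T-not⁻ {false} _ ()
T-not⁻ {true}  ()

¬T-not⇒T : ∀ {b} → ¬ T (not b) → T b
¬T-not⇒T {true}  _  = tt
¬T-not⇒T {false} ¬t = ¬t tt

T-∨ˡ : ∀ {b c} → T b → T (b ∨ c)
T-∨ˡ t = Equivalence.from T-∨ (inj₁ t)

T-∨ʳ : ∀ {b c} → T c → T (b ∨ c)
T-∨ʳ t = Equivalence.from T-∨ (inj₂ t)

module _ (p : A → Bool) where

  boolFilter≗filterᵇ : boolFilter p ≗ filterᵇ p
  boolFilter≗filterᵇ []       = refl
  boolFilter≗filterᵇ (x ∷ xs) with p x
  ... | true  = cong (x ∷_) (boolFilter≗filterᵇ xs)
  ... | false = boolFilter≗filterᵇ xs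

  ∈-boolFilter⁺ : x ∈ xs → T (p x) → x ∈ boolFilter p xs
  ∈-boolFilter⁺ {xs = xs} x∈xs px =
    subst (_ ∈_) (sym (boolFilter≗filterᵇ xs)) (∈-filter⁺ (T? ∘ p) x∈xs px)

  ∈-boolFilter⁻ : x ∈ boolFilter p xs → x ∈ xs × T (p x)
  ∈-boolFilter⁻ {xs = xs} = ∈-filter⁻ (T? ∘ p) ∘ subst (_ ∈_) (boolFilter≗filterᵇ xs)

  boolFilter-⊆ : ∀ xs → boolFilter p xs ⊆ xs
  boolFilter-⊆ xs = subst (_⊆ xs) (sym (boolFilter≗filterᵇ xs)) (filter-⊆ (T? ∘ p) xs)

  length-boolFilter-< : x ∈ xs → ¬ T (p x) → length (boolFilter p xs) < length xs
  length-boolFilter-< {xs = xs} x∈xs ¬px =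
    subst (λ ys → length ys < length xs) (sym (boolFilter≗filterᵇ xs))
          (filter-notAll (T? ∘ p) xs (Any.map (λ { refl → ¬px }) x∈xs))

  All-map-boolFilter : ∀ {B : Set} {f : A → B} {P : B → Set} →
    (∀ {x} → x ∈ xs → T (p x) → P (f x)) → All P (map f (boolFilter p xs))
  All-map-boolFilter {xs = xs} {f = f} {P} h = All.tabulate λ y∈ → at (∈-map⁻ f y∈)
    where
    at : ∀ {y} → ∃[ x ] x ∈ boolFilter p xs × y ≡ f x → P y
    at (_ , x∈ , refl) = let x∈xs , px = ∈-boolFilter⁻ x∈ in h x∈xs px

boolFilter-∧ : ∀ (p q : A → Bool) xs →
  boolFilter (λ x → p x ∧ q x) xs ≡ boolFilter q (boolFilter p xs)
boolFilter-∧ p q []       = refl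
boolFilter-∧ p q (x ∷ xs) with p x
... | false = boolFilter-∧ p q xs
... | true with q x
...   | true  = cong (x ∷_) (boolFilter-∧ p q xs)
...   | false = boolFilter-∧ p q xs

∈-sublists⁺ : ys ⊆ xs → ys ∈ sublists xs
∈-sublists⁺ []                     = here refl
∈-sublists⁺ (_ ∷ʳ τ)               = ∈-++⁺ˡ (∈-sublists⁺ τ)
∈-sublists⁺ (_∷_ {ys = ys} refl τ) = ∈-++⁺ʳ (sublists ys) (∈-map⁺ _ (∈-sublists⁺ τ))

∈-sublists⁻ : ∀ xs → ys ∈ sublists xs → ys ⊆ xs
∈-sublists⁻ []       (here refl) = []
∈-sublists⁻ (x ∷ xs) ys∈ with ∈-++⁻ (sublists xs) ys∈
... | inj₁ ys∈′ = x ∷ʳ ∈-sublists⁻ xs ys∈′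
... | inj₂ ys∈′ with ∈-map⁻ (x ∷_) ys∈′
...   | _ , zs∈ , refl = refl ∷ ∈-sublists⁻ xs zs∈

maxList-upper : ∀ {m ms} → m ∈ ms → m ≤ maxList ms
maxList-upper {ms = k ∷ ks} (here refl) = m≤m⊔n k (maxList ks)
maxList-upper {ms = k ∷ ks} (there m∈) = m≤n⇒m≤o⊔n k (maxList-upper m∈)

maxList-least : ∀ {k ms} → All (_≤ k) ms → maxList ms ≤ k
maxList-least []         = z≤n
maxList-least (m≤ ∷ ms≤) = ⊔-lub m≤ (maxList-least ms≤)

minList-lower : ∀ {m ms} → m ∈ ms → minList ms ≤ m
minList-lower {ms = k ∷ ks} m∈ =
  foldr-preservesᵒ (λ a b → [ m≤n⇒m⊓o≤n b , m≤n⇒o⊓m≤n a ]′) k ks (≤-at m∈)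
  where
  ≤-at : ∀ {m k ks} → m ∈ k ∷ ks → k ≤ m ⊎ Any (_≤ m) ks
  ≤-at (here refl) = inj₁ ≤-refl
  ≤-at (there m∈)  = inj₂ (Any.map (λ { refl → ≤-refl }) m∈)

-- The membership hypothesis only rules out minList [] = 0.
minList-greatest : ∀ {k m ms} → m ∈ ms → All (k ≤_) ms → k ≤ minList ms
minList-greatest _ (k≤ ∷ ks≤) = foldr-preservesᵇ ⊓-glb k≤ ks≤

∈⇒0<length : x ∈ xs → 0 < length xs
∈⇒0<length {xs = _ ∷ _} _ = s≤s z≤n

AllPairs-resp-⊆ : ∀ {R : A → A → Set} → xs ⊆ ys → AllPairs R ys → AllPairs R xs
AllPairs-resp-⊆ []         []       = []
AllPairs-resp-⊆ (_ ∷ʳ τ)   (_ ∷ rs) = AllPairs-resp-⊆ τ rs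
AllPairs-resp-⊆ (refl ∷ τ) (r ∷ rs) = All-resp-⊆ τ r ∷ AllPairs-resp-⊆ τ rs

AllPairs-∈ : ∀ {R : A → A → Set} → Symmetric R → AllPairs R xs →
             x ∈ xs → y ∈ xs → x ≢ y → R x y
AllPairs-∈ _     _        (here refl) (here refl) x≢y = ⊥-elim (x≢y refl)
AllPairs-∈ _     (r ∷ _)  (here refl) (there y∈) _    = All.lookup r y∈
AllPairs-∈ R-sym (r ∷ _)  (there x∈)  (here refl) _   = R-sym (All.lookup r x∈)
AllPairs-∈ R-sym (_ ∷ rs) (there x∈)  (there y∈) x≢y  = AllPairs-∈ R-sym rs x∈ y∈ x≢y

module _ {P : A → Set} (P? : Decidable P) where

  length-filter+filter-∁ : ∀ xs → length (filter P? xs) + length (filter (∁? P?) xs) ≡ length xs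
  length-filter+filter-∁ []       = refl
  length-filter+filter-∁ (x ∷ xs) with does (P? x)
  ... | true  = cong suc (length-filter+filter-∁ xs)
  ... | false = trans (+-suc _ _) (cong suc (length-filter+filter-∁ xs))

  length-filter≤1 : ∀ {xs} {R : A → A → Set} → (∀ {x y} → R x y → P x → ¬ P y) →
                    AllPairs R xs → length (filter P? xs) ≤ 1
  length-filter≤1 _    []                 = z≤n
  length-filter≤1 {x ∷ xs} excl (rs ∷ rss) with P? x
  ... | no  _  = length-filter≤1 excl rss
  ... | yes px = s≤s (≤-reflexive (cong length (filter-none P? (All.map (λ r → excl r px) rs))))

  length≤1+length-filter-∁ : ∀ {R : A → A → Set} → (∀ {x y} → R x y → P x → ¬ P y) →
                             AllPairs R xs → length xs ≤ 1 + length (filter (∁? P?) xs)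
  length≤1+length-filter-∁ {xs = xs} excl rs = begin
    length xs                                         ≡⟨ length-filter+filter-∁ xs ⟨
    length (filter P? xs) + length (filter (∁? P?) xs) ≤⟨ +-monoˡ-≤ _ (length-filter≤1 excl rs) ⟩
    1 + length (filter (∁? P?) xs)                     ∎
    where open ≤-Reasoning

module _ {B : Set} {Q : A → A → Set} {R : A → B → Set} (R? : ∀ x b → Dec (R x b)) where

  length-≤-pigeonhole : ∀ {xs} bs → AllPairs Q xs →
    All (λ b → ∀ {x y} → Q x y → R x b → ¬ R y b) bs →
    All (λ x → Any (R x) bs) xs → length xs ≤ length bs
  length-≤-pigeonhole []       _  _              []       = z≤n
  length-≤-pigeonhole []       _  _              (() ∷ _)
  length-≤-pigeonhole {xs} (b ∷ bs) qs (excl ∷ excls) covered =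
    ≤-trans (length≤1+length-filter-∁ R?b excl qs)
            (s≤s (length-≤-pigeonhole bs (AllPairsₚ.filter⁺ (∁? R?b) qs) excls covered-by-bs))
    where
    R?b = λ x → R? x b
    covered-by-bs : All (λ x → Any (R x) bs) (filter (∁? R?b) xs)
    covered-by-bs = All.tabulate λ x∈ →
      let x∈xs , ¬r = ∈-filter⁻ (∁? R?b) x∈ in Any.tail ¬r (All.lookup covered x∈xs)

module _ (G : Graph) where

  -- Independent sets and vertex covers

  private variable
    u v w : V G
    S : V G → Bool
    F I J : List (V G)
    M : List (Edge G)
    e f : Edge G
    k : ℕ

  open DecMembership (_≟ᶠ_ {n G}) using (_∈?_)

  adj-sym : T (adj G u w) → T (adj G w u)
  adj-sym {u} {w} = subst T (Graph.sym G u w)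

  adj-irrefl : ¬ T (adj G v v)
  adj-irrefl {v} = subst T (Graph.irrefl G v)

  infix 4 _≁_
  _≁_ : V G → V G → Set
  u ≁ w = u ≢ w × ¬ T (adj G u w)

  ≁-sym : Symmetric _≁_
  ≁-sym (u≢w , ¬uw) = ≢-sym u≢w , ¬uw ∘ adj-sym

  Independent : List (V G) → Set
  Independent I = ∀ {u w} → u ∈ I → w ∈ I → ¬ T (adj G u w)

  Independent-∷ : All (λ u → ¬ T (adj G v u)) I → Independent I → Independent (v ∷ I)
  Independent-∷ _   _   (here refl) (here refl) = adj-irrefl
  Independent-∷ ¬vI _   (here refl) (there w∈)  = All.lookup ¬vI w∈
  Independent-∷ ¬vI _   (there u∈)  (here refl) = All.lookup ¬vI u∈ ∘ adj-sym
  Independent-∷ _   ind (there u∈)  (there w∈)  = ind u∈ w∈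

  Unique∧Independent⇒AllPairs-≁ : Unique I → Independent I → AllPairs _≁_ I
  Unique∧Independent⇒AllPairs-≁ []              _   = []
  Unique∧Independent⇒AllPairs-≁ (v∉I ∷ uniq) ind =
    All.tabulate (λ w∈ → All.lookup v∉I w∈ , ind (here refl) (there w∈))
    ∷ Unique∧Independent⇒AllPairs-≁ uniq (λ u∈ w∈ → ind (there u∈) (there w∈))

  independentᵇ⁺ : Independent I → T (independentᵇ G I)
  independentᵇ⁺ ind =
    all⁻ _ (All.tabulate λ u∈ → all⁻ _ (All.tabulate λ w∈ → T-not⁺ (ind u∈ w∈)))

  independentᵇ⁻ : T (independentᵇ G I) → Independent I
  independentᵇ⁻ {I} t u∈ w∈ =
    T-not⁻ (All.lookup (all⁺ _ I (All.lookup (all⁺ _ I t) u∈)) w∈)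

  eqᵇ-refl : T (eqᵇ G v v)
  eqᵇ-refl {v} = fromWitness {a? = v ≟ᶠ v} refl

  eqᵇ⇒≡ : T (eqᵇ G u w) → u ≡ w
  eqᵇ⇒≡ {u} {w} = toWitness {a? = u ≟ᶠ w}

  memᵇ⁺ : v ∈ F → T (memᵇ G v F)
  memᵇ⁺ v∈ = any⁺ _ (Any.map (λ { refl → eqᵇ-refl }) v∈)

  memᵇ⁻ : T (memᵇ G v F) → v ∈ F
  memᵇ⁻ {F = F} t = Any.map eqᵇ⇒≡ (any⁻ _ F t)

  IsVertexCover : List (V G) → Set
  IsVertexCover F = ∀ {u w} → T (adj G u w) → u ∈ F ⊎ w ∈ F

  private
    complement : List (V G) → List (V G)
    complement F = boolFilter (λ v → not (memᵇ G v F)) (vertices G)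

    ∈-complement⁺ : v ∉ F → v ∈ complement F
    ∈-complement⁺ {v = v} {F = F} v∉ =
      ∈-boolFilter⁺ (λ v → not (memᵇ G v F)) (∈-allFin v) (T-not⁺ (v∉ ∘ memᵇ⁻))

    ∈-complement⁻ : v ∈ complement F → v ∉ F
    ∈-complement⁻ {F = F} v∈ =
      T-not⁻ (proj₂ (∈-boolFilter⁻ (λ v → not (memᵇ G v F)) {xs = vertices G} v∈)) ∘ memᵇ⁺

  isVertexCoverᵇ⁺ : IsVertexCover F → T (isVertexCoverᵇ G F)
  isVertexCoverᵇ⁺ cover = independentᵇ⁺ λ u∈ w∈ uw →
    [ ∈-complement⁻ u∈ , ∈-complement⁻ w∈ ]′ (cover uw)

  isVertexCoverᵇ⁻ : T (isVertexCoverᵇ G F) → IsVertexCover F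
  isVertexCoverᵇ⁻ {F} t {u} {w} uw with u ∈? F | w ∈? F
  ... | yes u∈ | _      = inj₁ u∈
  ... | no _   | yes w∈ = inj₂ w∈
  ... | no u∉  | no w∉  = ⊥-elim (independentᵇ⁻ t (∈-complement⁺ u∉) (∈-complement⁺ w∉) uw)

  α-upper : J ⊆ F → Independent J → length J ≤ α G F
  α-upper J⊆F ind = maxList-upper
    (∈-map⁺ length (∈-boolFilter⁺ (independentᵇ G) (∈-sublists⁺ J⊆F) (independentᵇ⁺ ind)))

  α-least : (∀ {J} → J ⊆ F → Independent J → length J ≤ k) → α G F ≤ k
  α-least {F} bound = maxList-least
    (All-map-boolFilter (independentᵇ G) λ J∈ t → bound (∈-sublists⁻ F J∈) (independentᵇ⁻ t))

  length-≤-α : Unique I → Independent I → All (_∈ F) I → length I ≤ α G F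
  length-≤-α {I} {F} uniq ind I⊆F = begin
    length I   ≤⟨ length-≤-pigeonhole _≟ᶠ_ F∩I uniq
                    (All.tabulate λ _ x≢y → λ { refl refl → x≢y refl })
                    (All.tabulate λ x∈I → ∈-filter⁺ (_∈? I) (All.lookup I⊆F x∈I) x∈I) ⟩
    length F∩I ≤⟨ α-upper (filter-⊆ (_∈? I) F) (λ u∈ w∈ → ind (∈I u∈) (∈I w∈)) ⟩
    α G F      ∎
    where
    open ≤-Reasoning
    F∩I = filter (_∈? I) F
    ∈I : ∀ {u} → u ∈ F∩I → u ∈ I
    ∈I = proj₂ ∘ ∈-filter⁻ (_∈? I) {xs = F}

  ccn-lower : F ⊆ vertices G → IsVertexCover F → ccn G ≤ α G F
  ccn-lower F⊆ cover = minList-lower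
    (∈-map⁺ (α G) (∈-boolFilter⁺ (isVertexCoverᵇ G) (∈-sublists⁺ F⊆) (isVertexCoverᵇ⁺ cover)))

  ccn-greatest : (∀ {F} → F ⊆ vertices G → IsVertexCover F → k ≤ α G F) → k ≤ ccn G
  ccn-greatest bound = minList-greatest
    (∈-map⁺ (α G) (∈-boolFilter⁺ (isVertexCoverᵇ G) (∈-sublists⁺ (⊆-refl {x = vertices G}))
      (isVertexCoverᵇ⁺ λ {u} _ → inj₁ (∈-allFin u))))
    (All-map-boolFilter (isVertexCoverᵇ G) λ F∈ t →
      bound (∈-sublists⁻ (vertices G) F∈) (isVertexCoverᵇ⁻ t))

  infix 4 _∈ₑ_ _∈ₑ?_
  _∈ₑ_ : V G → Edge G → Set
  x ∈ₑ e = x ≡ proj₁ e ⊎ x ≡ proj₂ e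

  _∈ₑ?_ : ∀ x e → Dec (x ∈ₑ e)
  x ∈ₑ? e = (x ≟ᶠ proj₁ e) ⊎-dec (x ≟ᶠ proj₂ e)

  private
    orderedAdjᵇ : Edge G → Bool
    orderedAdjᵇ e = (toℕ (proj₁ e) <ᵇ toℕ (proj₂ e)) ∧ adj G (proj₁ e) (proj₂ e)

    vertexPairs : List (Edge G)
    vertexPairs = concatMap (λ u → map (u ,_) (vertices G)) (vertices G)

  edges-adj : e ∈ edges G → T (adj G (proj₁ e) (proj₂ e))
  edges-adj e∈ =
    proj₂ (Equivalence.to T-∧ (proj₂ (∈-boolFilter⁻ orderedAdjᵇ {xs = vertexPairs} e∈)))

  endpoints-adj : ∀ {x y} → e ∈ edges G → x ∈ₑ e → y ∈ₑ e → x ≢ y → T (adj G x y)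
  endpoints-adj _  (inj₁ refl) (inj₁ refl) x≢y = ⊥-elim (x≢y refl)
  endpoints-adj e∈ (inj₁ refl) (inj₂ refl) _   = edges-adj e∈
  endpoints-adj e∈ (inj₂ refl) (inj₁ refl) _   = adj-sym (edges-adj e∈)
  endpoints-adj _  (inj₂ refl) (inj₂ refl) x≢y = ⊥-elim (x≢y refl)

  ∈-edges : toℕ u < toℕ w → T (adj G u w) → (u , w) ∈ edges G
  ∈-edges {u} {w} u<w uw = ∈-boolFilter⁺ orderedAdjᵇ
    (∈-concatMap⁺ (λ v → map (v ,_) (vertices G))
      (Any.map (λ { refl → ∈-map⁺ (u ,_) (∈-allFin w) }) (∈-allFin u)))
    (Equivalence.from T-∧ (<⇒<ᵇ u<w , uw))

  edge-between : T (adj G u w) →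
                 ∃[ e ] e ∈ edges G × (∀ {x} → x ∈ₑ e → x ≡ u ⊎ x ≡ w)
  edge-between {u} {w} uw with <-cmpᶠ u w
  ... | tri< u<w _ _  = (u , w) , ∈-edges u<w uw , λ x∈ → x∈
  ... | tri≈ _ refl _ = ⊥-elim (adj-irrefl uw)
  ... | tri> _ _ w<u  = (w , u) , ∈-edges w<u (adj-sym uw) , [ inj₂ , inj₁ ]′

  -- disjointᵇ G e f and unjoinedᵇ G e f unfold to not (anyPairᵇ (eqᵇ G) e f) and
  -- not (anyPairᵇ (adj G) e f).
  anyPairᵇ : (V G → V G → Bool) → Edge G → Edge G → Bool
  anyPairᵇ r (a , b) (c , d) = r a c ∨ r a d ∨ r b c ∨ r b d

  anyPairᵇ⁺ : ∀ {r e f x y} → x ∈ₑ e → y ∈ₑ f → T (r x y) → T (anyPairᵇ r e f)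
  anyPairᵇ⁺ {r = r} {a , b} {c , d} (inj₁ refl) (inj₁ refl) t = T-∨ˡ {r a c} t
  anyPairᵇ⁺ {r = r} {a , b} {c , d} (inj₁ refl) (inj₂ refl) t = T-∨ʳ {r a c} (T-∨ˡ {r a d} t)
  anyPairᵇ⁺ {r = r} {a , b} {c , d} (inj₂ refl) (inj₁ refl) t =
    T-∨ʳ {r a c} (T-∨ʳ {r a d} (T-∨ˡ {r b c} t))
  anyPairᵇ⁺ {r = r} {a , b} {c , d} (inj₂ refl) (inj₂ refl) t =
    T-∨ʳ {r a c} (T-∨ʳ {r a d} (T-∨ʳ {r b c} t))

  anyPairᵇ⁻ : ∀ {r e f} → T (anyPairᵇ r e f) → ∃[ x ] ∃[ y ] x ∈ₑ e × y ∈ₑ f × T (r x y)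
  anyPairᵇ⁻ {r} {a , b} {c , d} t with Equivalence.to (T-∨ {r a c}) t
  ... | inj₁ ac = a , c , inj₁ refl , inj₁ refl , ac
  ... | inj₂ t′ with Equivalence.to (T-∨ {r a d}) t′
  ...   | inj₁ ad = a , d , inj₁ refl , inj₂ refl , ad
  ...   | inj₂ t″ with Equivalence.to (T-∨ {r b c}) t″
  ...     | inj₁ bc = b , c , inj₂ refl , inj₁ refl , bc
  ...     | inj₂ bd = b , d , inj₂ refl , inj₂ refl , bd

  -- The recursion defining θ

  size : (V G → Bool) → ℕ
  size S = length (boolFilter S (vertices G))

  size-≤-n : ∀ S → size S ≤ n G
  size-≤-n S = begin
    size S                ≤⟨ length-mono-≤ (boolFilter-⊆ S (vertices G)) ⟩
    length (vertices G)   ≡⟨ length-tabulate id ⟩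
    n G                   ∎
    where open ≤-Reasoning

  size-pos : T (S v) → 0 < size S
  size-pos {S} {v} sv = ∈⇒0<length (∈-boolFilter⁺ S (∈-allFin v) sv)

  size-∧-< : ∀ {S q} → T (S v) → ¬ T (q v) → size (λ u → S u ∧ q u) < size S
  size-∧-< {v} {S} {q} sv ¬qv = begin-strict
    size (λ u → S u ∧ q u)
      ≡⟨ cong length (boolFilter-∧ S q (vertices G)) ⟩
    length (boolFilter q (boolFilter S (vertices G)))
      <⟨ length-boolFilter-< q (∈-boolFilter⁺ S (∈-allFin v) sv) ¬qv ⟩
    size S
      ∎
    where open ≤-Reasoning

  delete⁺ : T (S u) → u ≢ v → T (delete G S v u)
  delete⁺ su u≢v = Equivalence.from T-∧ (su , T-not⁺ (u≢v ∘ eqᵇ⇒≡))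

  delete⁻ : T (delete G S v u) → T (S u)
  delete⁻ {S} {v} {u} = proj₁ ∘ Equivalence.to (T-∧ {S u})

  size-delete-< : T (S v) → size (delete G S v) < size S
  size-delete-< {S} {v} sv = size-∧-< {q = λ u → not (eqᵇ G u v)} sv λ t → T-not⁻ t eqᵇ-refl

  deleteClosedNbhd⁺ : T (S u) → u ≢ v → ¬ T (adj G v u) → T (deleteClosedNbhd G S v u)
  deleteClosedNbhd⁺ su u≢v ¬vu =
    Equivalence.from T-∧ (su , Equivalence.from T-∧ (T-not⁺ (u≢v ∘ eqᵇ⇒≡) , T-not⁺ ¬vu))

  deleteClosedNbhd⁻ : T (deleteClosedNbhd G S v u) → T (S u) × u ≢ v × ¬ T (adj G v u)
  deleteClosedNbhd⁻ {S} {v} {u} t =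
    let su , rest = Equivalence.to (T-∧ {S u}) t
        u≉v , ¬vu = Equivalence.to (T-∧ {not (eqᵇ G u v)}) rest
    in su , T-not⁻ u≉v ∘ fromWitness , T-not⁻ ¬vu

  size-deleteClosedNbhd-< : T (S v) → size (deleteClosedNbhd G S v) < size S
  size-deleteClosedNbhd-< {S} {v} sv =
    size-∧-< {q = λ u → not (eqᵇ G u v) ∧ not (adj G v u)} sv λ t →
      T-not⁻ (proj₁ (Equivalence.to (T-∧ {not (eqᵇ G v v)}) t)) eqᵇ-refl

  nonIsolatedᵇ⁺ : T (S v) → T (S u) → T (adj G v u) → T (nonIsolatedᵇ G S v)
  nonIsolatedᵇ⁺ {S} {v} {u} sv su vu = Equivalence.from T-∧
    (sv , any⁺ _ (Any.map (λ { refl → Equivalence.from (T-∧ {S u}) (su , vu) }) (∈-allFin u)))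

  nonIsolatedᵇ⁻ : T (nonIsolatedᵇ G S v) → T (S v)
  nonIsolatedᵇ⁻ {S} {v} = proj₁ ∘ Equivalence.to (T-∧ {S v})

  hasEdgeᵇ⁺ : e ∈ edges G → T (S (proj₁ e)) → T (S (proj₂ e)) → T (hasEdgeᵇ G S)
  hasEdgeᵇ⁺ {S = S} e∈ s₁ s₂ =
    any⁺ _ (Any.map (λ { refl → Equivalence.from (T-∧ {S _}) (s₁ , s₂) }) e∈)

  hasEdgeᵇ⁻ : T (hasEdgeᵇ G S) → ∃[ e ] e ∈ edges G × T (S (proj₁ e)) × T (S (proj₂ e))
  hasEdgeᵇ⁻ {S} t with find (any⁻ _ (edges G) t)
  ... | e , e∈ , s = e , e∈ , Equivalence.to (T-∧ {S (proj₁ e)}) s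

  θ-branch : ℕ → (V G → Bool) → V G → ℕ
  θ-branch f S v = θ-aux G f (delete G S v) ⊔ suc (θ-aux G f (deleteClosedNbhd G S v))

  θ-aux-suc-≤ : ∀ {f S k} →
                (T (hasEdgeᵇ G S) → ∃[ v ] T (nonIsolatedᵇ G S v) × θ-branch f S v ≤ k) →
                θ-aux G (suc f) S ≤ k
  θ-aux-suc-≤ {f} {S} branch with hasEdgeᵇ G S
  ... | false = z≤n
  ... | true with branch tt
  ...   | v , ni , ≤k = ≤-trans (minList-lower
    (∈-map⁺ (θ-branch f S) (∈-boolFilter⁺ (nonIsolatedᵇ G S) (∈-allFin v) ni))) ≤k

  θ-aux-suc : ∀ {f S} → T (hasEdgeᵇ G S) →
              θ-aux G (suc f) S ≡
              minList (map (θ-branch f S) (boolFilter (nonIsolatedᵇ G S) (vertices G)))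
  θ-aux-suc {S = S} he with hasEdgeᵇ G S
  ... | true = refl

  ≤-θ-aux-suc : ∀ {f S k} → T (hasEdgeᵇ G S) →
                (∀ {v} → T (nonIsolatedᵇ G S v) → k ≤ θ-branch f S v) →
                k ≤ θ-aux G (suc f) S
  ≤-θ-aux-suc {f} {S} {k} he branch with hasEdgeᵇ⁻ he
  ... | e , e∈ , s₁ , s₂ = subst (k ≤_) (sym (θ-aux-suc {f} he)) (minList-greatest
    (∈-map⁺ (θ-branch f S) (∈-boolFilter⁺ (nonIsolatedᵇ G S) (∈-allFin (proj₁ e))
      (nonIsolatedᵇ⁺ s₁ s₂ (edges-adj e∈))))
    (All-map-boolFilter (nonIsolatedᵇ G S) {xs = vertices G} λ _ ni → branch ni))

  -- Induced matchings

  Far : Edge G → Edge G → Set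
  Far e f = ∀ {x y} → x ∈ₑ e → y ∈ₑ f → x ≁ y

  Far-sym : Symmetric Far
  Far-sym far y∈ x∈ = ≁-sym (far x∈ y∈)

  disjoint∧unjoined⇒Far : T (disjointᵇ G e f ∧ unjoinedᵇ G e f) → Far e f
  disjoint∧unjoined⇒Far {e} {f} t x∈ y∈ =
    let disjoint , unjoined = Equivalence.to (T-∧ {disjointᵇ G e f}) t in
    (λ { refl → T-not⁻ disjoint (anyPairᵇ⁺ {r = eqᵇ G} x∈ y∈ eqᵇ-refl) }) ,
    T-not⁻ unjoined ∘ anyPairᵇ⁺ {r = adj G} x∈ y∈

  isInducedMatchingᵇ⁻ : ∀ {M} → T (isInducedMatchingᵇ G M) → AllPairs Far M
  isInducedMatchingᵇ⁻ {[]}    _ = []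
  isInducedMatchingᵇ⁻ {e ∷ M} t =
    let farFromRest , rest =
          Equivalence.to (T-∧ {all (λ f → disjointᵇ G e f ∧ unjoinedᵇ G e f) M}) t
    in All.map disjoint∧unjoined⇒Far (all⁺ _ M farFromRest) ∷ isInducedMatchingᵇ⁻ rest

  im-least : (∀ {M} → M ⊆ edges G → T (isInducedMatchingᵇ G M) → length M ≤ k) → im G ≤ k
  im-least bound = maxList-least
    (All-map-boolFilter (isInducedMatchingᵇ G) λ M∈ t → bound (∈-sublists⁻ (edges G) M∈) t)

  Within : (V G → Bool) → Edge G → Set
  Within S e = ∀ x → x ∈ₑ e → T (S x)

  Within-delete : ¬ v ∈ₑ e → Within S e → Within (delete G S v) e
  Within-delete {S = S} v∉e within x x∈ = delete⁺ {S = S} (within x x∈) λ { refl → v∉e x∈ }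

  Within-deleteClosedNbhd : Far e f → v ∈ₑ e → Within S f → Within (deleteClosedNbhd G S v) f
  Within-deleteClosedNbhd {S = S} far v∈e within x x∈ =
    let v≢x , ¬vx = far v∈e x∈ in deleteClosedNbhd⁺ {S = S} (within x x∈) (≢-sym v≢x) ¬vx

  -- θ-aux returns 0 once its fuel runs out, hence the hypothesis size S ≤ f.
  induced-matching-≤-θ-aux : ∀ f S {M} → size S ≤ f → AllPairs Far M →
                             All (λ e → e ∈ edges G × Within S e) M → length M ≤ θ-aux G f S
  induced-matching-≤-θ-aux _       _ _     _     []                  = z≤n
  induced-matching-≤-θ-aux zero    S size≤ _     ((_ , within) ∷ _)  =
    ⊥-elim (<⇒≱ (size-pos (within _ (inj₁ refl))) size≤)
  induced-matching-≤-θ-aux (suc f) S {M} size≤ farM M⊆S@((e∈ , within) ∷ _) =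
    ≤-θ-aux-suc {f} {S} (hasEdgeᵇ⁺ {S = S} e∈ (within _ (inj₁ refl)) (within _ (inj₂ refl)))
      (≤-branch ∘ nonIsolatedᵇ⁻)
    where
    ≤-branch : ∀ {v} → T (S v) → length M ≤ θ-branch f S v
    ≤-branch {v} sv with Any.any? (v ∈ₑ?_) M
    ... | no v∉M = m≤n⇒m≤n⊔o _ (induced-matching-≤-θ-aux f (delete G S v)
          (≤-pred (<-≤-trans (size-delete-< sv) size≤)) farM
          (All.zipWith (λ (v∉e , e∈ , within) → e∈ , Within-delete v∉e within)
            (¬Any⇒All¬ M v∉M , M⊆S)))
    ... | yes v∈M with find v∈M
    ...   | e₀ , e₀∈M , v∈e₀ = m≤n⇒m≤o⊔n _ (begin
      length M
        ≤⟨ length≤1+length-filter-∁ (v ∈ₑ?_) (λ far v∈e v∈f → proj₁ (far v∈e v∈f) refl) farM ⟩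
      suc (length M′)
        ≤⟨ s≤s (induced-matching-≤-θ-aux f (deleteClosedNbhd G S v)
                 (≤-pred (<-≤-trans (size-deleteClosedNbhd-< sv) size≤))
                 (AllPairsₚ.filter⁺ (∁? (v ∈ₑ?_)) farM) M′⊆S−N[v]) ⟩
      suc (θ-aux G f (deleteClosedNbhd G S v))
        ∎)
      where
      open ≤-Reasoning
      M′ = filter (∁? (v ∈ₑ?_)) M
      M′⊆S−N[v] : All (λ e → e ∈ edges G × Within (deleteClosedNbhd G S v) e) M′
      M′⊆S−N[v] = All.tabulate λ e∈M′ →
        let e∈M , v∉e = ∈-filter⁻ (∁? (v ∈ₑ?_)) e∈M′
            e∈ , within = All.lookup M⊆S e∈M
            e₀-far-e = AllPairs-∈ Far-sym farM e₀∈M e∈M λ { refl → v∉e v∈e₀ }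
        in e∈ , Within-deleteClosedNbhd e₀-far-e v∈e₀ within

  im≤θ : im G ≤ θ G
  im≤θ = im-least λ M⊆E induced → induced-matching-≤-θ-aux (n G) (λ _ → true) (size-≤-n _)
    (isInducedMatchingᵇ⁻ induced) (All.tabulate λ e∈M → Any-resp-⊆ M⊆E e∈M , λ _ _ → tt)

  -- Bounding θ by vertex covers

  Covers : (V G → Set) → (V G → Bool) → Set
  Covers C S = ∀ {u w} → T (S u) → T (S w) → T (adj G u w) → C u ⊎ C w

  Covers-anti : ∀ {C S S′} → (∀ {u} → T (S′ u) → T (S u)) → Covers C S → Covers C S′
  Covers-anti S′⊆S cover su sw = cover (S′⊆S su) (S′⊆S sw)

  covered-nonIsolated : ∀ {C S} → Covers C S → T (hasEdgeᵇ G S) →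
                        ∃[ c ] C c × T (nonIsolatedᵇ G S c)
  covered-nonIsolated cover he with hasEdgeᵇ⁻ he
  ... | (a , b) , e∈ , sa , sb with cover sa sb (edges-adj e∈)
  ...   | inj₁ ca = a , ca , nonIsolatedᵇ⁺ sa sb (edges-adj e∈)
  ...   | inj₂ cb = b , cb , nonIsolatedᵇ⁺ sb sa (adj-sym (edges-adj e∈))

  IndependenceAtMost : (V G → Set) → ℕ → Set
  IndependenceAtMost P k = ∀ {I} → Unique I → Independent I → All P I → length I ≤ k

  IndependenceAtMost-anti : ∀ {P Q} → (∀ {u} → P u → Q u) →
                            IndependenceAtMost Q k → IndependenceAtMost P k
  IndependenceAtMost-anti P⇒Q bound uniq ind all = bound uniq ind (All.map P⇒Q all)

  IndependenceAtMost-zero : ∀ {P} → IndependenceAtMost P 0 → ¬ P v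
  IndependenceAtMost-zero bound pv with () ← bound ([] ∷ []) (Independent-∷ [] λ ()) (pv ∷ [])

  IndependenceAtMost-suc : ∀ {P} → IndependenceAtMost P (suc k) → P v →
                           IndependenceAtMost (λ u → P u × u ≢ v × ¬ T (adj G v u)) k
  IndependenceAtMost-suc bound pv uniq ind all = ≤-pred (bound
    (All.map (≢-sym ∘ proj₁ ∘ proj₂) all ∷ uniq)
    (Independent-∷ (All.map (proj₂ ∘ proj₂) all) ind)
    (pv ∷ All.map proj₁ all))

  θ-aux-≤-independence : ∀ f S {C k} → Covers C S → IndependenceAtMost (λ u → C u × T (S u)) k →
                         θ-aux G f S ≤ k
  θ-aux-≤-independence zero    _ _     _     = z≤n
  θ-aux-≤-independence (suc f) S {C} {k} cover bound = θ-aux-suc-≤ {f} {S} λ he →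
    let c , cc , ni = covered-nonIsolated cover he
    in c , ni , ⊔-lub (≤-delete c) (≤-deleteClosedNbhd bound cc (nonIsolatedᵇ⁻ ni))
    where
    ≤-delete : ∀ c → θ-aux G f (delete G S c) ≤ k
    ≤-delete c = θ-aux-≤-independence f (delete G S c) (Covers-anti (delete⁻ {S = S}) cover)
      (IndependenceAtMost-anti (λ (cu , su) → cu , delete⁻ {S = S} su) bound)
    ≤-deleteClosedNbhd : ∀ {k c} → IndependenceAtMost (λ u → C u × T (S u)) k → C c → T (S c) →
                         suc (θ-aux G f (deleteClosedNbhd G S c)) ≤ k
    ≤-deleteClosedNbhd {zero}  bound cc sc = ⊥-elim (IndependenceAtMost-zero bound (cc , sc))
    ≤-deleteClosedNbhd {suc k} bound cc sc = s≤s (θ-aux-≤-independence f (deleteClosedNbhd G S _)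
      (Covers-anti (proj₁ ∘ deleteClosedNbhd⁻ {S = S}) cover)
      (IndependenceAtMost-anti
        (λ (cu , du) → let su , u≢c , ¬cu = deleteClosedNbhd⁻ {S = S} du in (cu , su) , u≢c , ¬cu)
        (IndependenceAtMost-suc bound (cc , sc))))

  θ≤ccn : θ G ≤ ccn G
  θ≤ccn = ccn-greatest λ _ cover → θ-aux-≤-independence (n G) (λ _ → true) (λ _ _ → cover)
    λ uniq ind all → length-≤-α uniq ind (All.map proj₁ all)

  -- Maximal matchings

  Meets : Edge G → Edge G → Set
  Meets e f = ∃[ x ] x ∈ₑ e × x ∈ₑ f

  meets-of-¬disjoint : ¬ T (disjointᵇ G e f) → Meets e f
  meets-of-¬disjoint ¬dis with anyPairᵇ⁻ {eqᵇ G} (¬T-not⇒T ¬dis)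
  ... | x , y , x∈ , y∈ , x=y = x , x∈ , subst (_∈ₑ _) (sym (eqᵇ⇒≡ x=y)) y∈

  Blocked : List (Edge G) → Edge G → Set
  Blocked M e = e ∈ M ⊎ Any (λ f → ¬ T (disjointᵇ G e f)) M

  isMaximalMatchingᵇ⁺ : T (isMatchingᵇ G M) → All (Blocked M) (edges G) →
                        T (isMaximalMatchingᵇ G M)
  isMaximalMatchingᵇ⁺ {M} matching blocked =
    Equivalence.from T-∧ (matching , all⁻ _ (All.map blocked⇒ blocked))
    where
    blocked⇒ : ∀ {e} → Blocked M e → T (any (edgeEqᵇ G e) M ∨ not (isMatchingᵇ G (e ∷ M)))
    blocked⇒ {e} (inj₁ e∈M) = T-∨ˡ (any⁺ _ (Any.map (λ { refl →
      Equivalence.from (T-∧ {eqᵇ G (proj₁ e) (proj₁ e)}) (eqᵇ-refl , eqᵇ-refl) }) e∈M))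
    blocked⇒ (inj₂ clash) =
      T-∨ʳ (T-not⁺ λ t → Any¬⇒¬All clash (all⁺ _ M (proj₁ (Equivalence.to T-∧ t))))

  isMaximalMatchingᵇ⁻ : T (isMaximalMatchingᵇ G M) → e ∈ edges G → Any (Meets e) M
  isMaximalMatchingᵇ⁻ {M} {e} t e∈ with Equivalence.to T-∧ t
  ... | matching , maximal with Equivalence.to T-∨ (All.lookup (all⁺ _ (edges G) maximal) e∈)
  ...   | inj₁ equal = Any.map (λ {f} eq → proj₁ e , inj₁ refl ,
          inj₁ (eqᵇ⇒≡ (proj₁ (Equivalence.to (T-∧ {eqᵇ G (proj₁ e) (proj₁ f)}) eq))))
          (any⁻ _ M equal)
  ...   | inj₂ notMatching = Any.map meets-of-¬disjoint
          (¬All⇒Any¬ (T? ∘ disjointᵇ G e) M λ disjoint →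
            T-not⁻ notMatching (Equivalence.from T-∧ (all⁻ _ disjoint , matching)))

  -- A maximal matching exists, so min-m is not the junk value minList [] = 0.
  greedy : List (Edge G) → List (Edge G)
  greedy []       = []
  greedy (e ∷ es) = if all (disjointᵇ G e) (greedy es) then e ∷ greedy es else greedy es

  greedy-⊆ : ∀ es → greedy es ⊆ es
  greedy-⊆ []       = []
  greedy-⊆ (e ∷ es) with all (disjointᵇ G e) (greedy es)
  ... | true  = refl ∷ greedy-⊆ es
  ... | false = e ∷ʳ greedy-⊆ es

  greedy-isMatching : ∀ es → T (isMatchingᵇ G (greedy es))
  greedy-isMatching []       = tt
  greedy-isMatching (e ∷ es) with all (disjointᵇ G e) (greedy es) in eq
  ... | true  = Equivalence.from T-∧ (subst T (sym eq) tt , greedy-isMatching es)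
  ... | false = greedy-isMatching es

  greedy-blocks : ∀ es → All (Blocked (greedy es)) es
  greedy-blocks []       = []
  greedy-blocks (e ∷ es) with all (disjointᵇ G e) (greedy es) in eq
  ... | true  = inj₁ (here refl) ∷ All.map [ inj₁ ∘ there , inj₂ ∘ there ]′ (greedy-blocks es)
  ... | false = inj₂ (¬All⇒Any¬ (T? ∘ disjointᵇ G e) _ λ disjoint → subst T eq (all⁻ _ disjoint))
                ∷ greedy-blocks es

  min-m-greatest : (∀ {M} → M ⊆ edges G → T (isMaximalMatchingᵇ G M) → k ≤ length M) →
                   k ≤ min-m G
  min-m-greatest bound = minList-greatest
    (∈-map⁺ length (∈-boolFilter⁺ (isMaximalMatchingᵇ G) (∈-sublists⁺ (greedy-⊆ (edges G)))
      (isMaximalMatchingᵇ⁺ (greedy-isMatching (edges G)) (greedy-blocks (edges G)))))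
    (All-map-boolFilter (isMaximalMatchingᵇ G) λ M∈ t → bound (∈-sublists⁻ (edges G) M∈) t)

  saturated? : ∀ M v → Dec (Any (v ∈ₑ_) M)
  saturated? M v = Any.any? (v ∈ₑ?_) M

  saturated : List (Edge G) → List (V G)
  saturated M = filter (saturated? M) (vertices G)

  ∈-saturated : ∀ {M f v} → f ∈ M → v ∈ₑ f → v ∈ saturated M
  ∈-saturated {M} {v = v} f∈M v∈f = ∈-filter⁺ (saturated? M) (∈-allFin v) (lose f∈M v∈f)

  saturated-isVertexCover : (∀ {e} → e ∈ edges G → Any (Meets e) M) →
                            IsVertexCover (saturated M)
  saturated-isVertexCover meets uw with edge-between uw
  ... | e , e∈ , ends with find (meets e∈)
  ...   | f , f∈M , x , x∈e , x∈f with ends x∈e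
  ...     | inj₁ refl = inj₁ (∈-saturated f∈M x∈f)
  ...     | inj₂ refl = inj₂ (∈-saturated f∈M x∈f)

  α-saturated-≤ : M ⊆ edges G → α G (saturated M) ≤ length M
  α-saturated-≤ {M} M⊆E = α-least λ J⊆ ind →
    let J⊆V = ⊆-trans J⊆ (filter-⊆ (saturated? M) (vertices G)) in
    length-≤-pigeonhole _∈ₑ?_ M
      (Unique∧Independent⇒AllPairs-≁ (AllPairs-resp-⊆ J⊆V (allFin⁺ (n G))) ind)
      (All.tabulate λ e∈M x≁y x∈ y∈ →
        proj₂ x≁y (endpoints-adj (Any-resp-⊆ M⊆E e∈M) x∈ y∈ (proj₁ x≁y)))
      (All.tabulate λ x∈J →
        proj₂ (∈-filter⁻ (saturated? M) {xs = vertices G} (Any-resp-⊆ J⊆ x∈J)))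

  ccn≤min-m : ccn G ≤ min-m G
  ccn≤min-m = min-m-greatest λ {M} M⊆E maximal → begin
    ccn G              ≤⟨ ccn-lower (filter-⊆ (saturated? M) (vertices G))
                            (saturated-isVertexCover (isMaximalMatchingᵇ⁻ maximal)) ⟩
    α G (saturated M)  ≤⟨ α-saturated-≤ M⊆E ⟩
    length M           ∎
    where open ≤-Reasoning

proposition36 : (G : Graph) → (im G ≤ θ G) × (θ G ≤ ccn G) × (ccn G ≤ min-m G)
proposition36 G = im≤θ G , θ≤ccn G , ccn≤min-m G
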